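{- Let $\ell\geq 1$ and consider the grid gadget on $\ell\times\ell$ nodes. For any $2$-way (not necessarily balanced) partitioning of its nodes into two colors, if the less frequent color occurs at least $t_0$ times, then the number of cut hyperedges of the gadget is at least $\sqrt{t_0}$.
   Context: The grid gadget of size $\ell$ is the hypergraph whose nodes are arranged in an $\ell\times\ell$ grid and whose hyperedges are the $\ell$ rows and the $\ell$ columns (each a hyperedge of size $\ell$). A hyperedge is cut if it contains nodes of both colors. -}

module Defs where

open import Data.Nat using (ℕ; zero; suc; _+_; _*_)
open import Data.Bool using (Bool; true; false; not; _∧_; if_then_else_)
open import Data.Fin using (Fin)
open import Data.List using (List; map; allFin)
open import Data.Nat.ListAction using (sum)
open import Data.Bool.ListAction using (any)

-- A 2-coloring of the nodes of the ℓ×ℓ grid gadget: node (i , j) is in row i, column j.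
Coloring : ℕ → Set
Coloring ℓ = Fin ℓ → Fin ℓ → Bool

count : ∀ {n} → (Fin n → Bool) → ℕ
count {n} p = sum (map (λ i → if p i then 1 else 0) (allFin n))

-- a hyperedge (given by its node-color function) is cut iff it contains both colors
isCut : ∀ {n} → (Fin n → Bool) → Bool
isCut {n} e = any e (allFin n) ∧ any (λ x → not (e x)) (allFin n)

numTrue : ∀ {ℓ} → Coloring ℓ → ℕ
numTrue {ℓ} c = sum (map (λ i → count (c i)) (allFin ℓ))

numFalse : ∀ {ℓ} → Coloring ℓ → ℕ
numFalse {ℓ} c = sum (map (λ i → count (λ j → not (c i j))) (allFin ℓ))

-- number of cut hyperedges: cut rows plus cut columns
cutEdges : ∀ {ℓ} → Coloring ℓ → ℕ
cutEdges {ℓ} c = count (λ i → isCut (λ j → c i j)) + count (λ j → isCut (λ i → c i j))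

-- Let r and s be the numbers of cut rows and cut columns. If every row is cut, then
-- r = ℓ and the minority colour has at most ℓ² = r² nodes; symmetrically if every
-- column is cut. Otherwise there is an uncut row i₀ and an uncut column j₀; both are
-- monochromatic, so of the colour a of their crossing node. A node of colour not a
-- then cannot lie in an uncut row (which would be crossed by column j₀ and so have
-- colour a) nor in an uncut column, so there are at most r·s such nodes. In each case
-- the minority colour has at most (r + s)² nodes.
module Submission where

open import Defs
open import Data.Nat using (ℕ; _≤_; _*_; _⊓_; z≤n; s≤s)
open import Data.Nat.Properties using (≤-trans; ≤-reflexive; +-mono-≤; *-mono-≤; m≤m+n; m≤n+m; m⊓n≤m; m⊓n≤n)
open import Data.Bool using (Bool; true; false; not; _≟_; if_then_else_)
open import Data.Bool.Properties using (T-≡; T-not-≡; T-∧; ¬-not; not-¬; not-injective)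
open import Data.Fin using (Fin)
open import Data.Fin.Properties using (any?)
open import Data.List using (List; []; _∷_; map; allFin)
open import Data.List.Membership.Propositional using (lose)
open import Data.List.Membership.Propositional.Properties using (∈-allFin)
open import Data.List.Relation.Unary.Any.Properties using (any⁺)
open import Data.Nat.ListAction using (sum)
open import Data.Product using (∃; _,_)
open import Function.Bundles using (Equivalence)
open import Relation.Nullary using (¬_; yes; no; contradiction)
open import Relation.Binary.PropositionalEquality using (_≡_; refl; sym; trans)

-- count {n} p unfolds to countIn p (allFin n), so the lemmas below apply to count.
countIn : ∀ {A : Set} → (A → Bool) → List A → ℕ
countIn p xs = sum (map (λ x → if p x then 1 else 0) xs)

countIn-mono : ∀ {A : Set} {p q : A → Bool} → (∀ x → p x ≡ true → q x ≡ true) →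
               ∀ xs → countIn p xs ≤ countIn q xs
countIn-mono p⇒q [] = z≤n
countIn-mono {p = p} p⇒q (x ∷ xs) with p x in px
... | true  rewrite p⇒q x px = s≤s (countIn-mono p⇒q xs)
... | false = ≤-trans (countIn-mono p⇒q xs) (m≤n+m _ _)

countIn-none : ∀ {A : Set} {p : A → Bool} → (∀ x → p x ≡ false) → ∀ xs → countIn p xs ≡ 0
countIn-none none [] = refl
countIn-none none (x ∷ xs) rewrite none x = countIn-none none xs

countIn-⊆-rectangle : ∀ {A B : Set} {q : A → B → Bool} {r : A → Bool} {s : B → Bool} →
                      (∀ x y → q x y ≡ true → r x ≡ true) →
                      (∀ x y → q x y ≡ true → s y ≡ true) →
                      ∀ xs ys → sum (map (λ x → countIn (q x) ys) xs) ≤ countIn r xs * countIn s ys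
countIn-⊆-rectangle q⇒r q⇒s [] ys = z≤n
countIn-⊆-rectangle {q = q} {r = r} q⇒r q⇒s (x ∷ xs) ys with r x in rx
... | true  = +-mono-≤ (countIn-mono (q⇒s x) ys) (countIn-⊆-rectangle q⇒r q⇒s xs ys)
... | false = +-mono-≤ (≤-reflexive (countIn-none outside ys)) (countIn-⊆-rectangle q⇒r q⇒s xs ys)
  where
  outside : ∀ y → q x y ≡ false
  outside y = ¬-not λ qxy → contradiction (trans (sym (q⇒r x y qxy)) rx) λ ()

¬∃false⇒∀true : ∀ {n} {p : Fin n → Bool} → ¬ ∃ (λ i → p i ≡ false) → ∀ i → p i ≡ true
¬∃false⇒∀true noFalse i = ¬-not λ pi≡false → noFalse (i , pi≡false)

isCut-intro : ∀ {n} (e : Fin n → Bool) {j k} → e j ≡ true → e k ≡ false → isCut e ≡ true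
isCut-intro e {j} {k} ej ek = Equivalence.to T-≡ (Equivalence.from T-∧
  ( any⁺ e (lose (∈-allFin j) (Equivalence.from T-≡ ej))
  , any⁺ (λ x → not (e x)) (lose (∈-allFin k) (Equivalence.from T-not-≡ ek))))

uncut⇒monochromatic : ∀ {n} (e : Fin n → Bool) → isCut e ≡ false → ∀ j k → e j ≡ e k
uncut⇒monochromatic e uncut j k with e j in ej | e k in ek
... | true  | true  = refl
... | false | false = refl
... | true  | false = contradiction (trans (sym (isCut-intro e ej ek)) uncut) λ ()
... | false | true  = contradiction (trans (sym (isCut-intro e ek ej)) uncut) λ ()

module _ {ℓ : ℕ} (c : Coloring ℓ) where

  cutRow : Fin ℓ → Bool
  cutRow i = isCut (λ j → c i j)

  cutCol : Fin ℓ → Bool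
  cutCol j = isCut (λ i → c i j)

  numTrue≤square : {p : Fin ℓ → Bool} → (∀ i → p i ≡ true) → numTrue c ≤ count p * count p
  numTrue≤square all-p = countIn-⊆-rectangle (λ i _ _ → all-p i) (λ _ j _ → all-p j) (allFin ℓ) (allFin ℓ)

  module _ {i₀ j₀ : Fin ℓ} (row₀ : cutRow i₀ ≡ false) (col₀ : cutCol j₀ ≡ false) where

    offColour-cutRow : ∀ {a i j} → c i₀ j₀ ≡ a → c i j ≡ not a → cutRow i ≡ true
    offColour-cutRow {i = i} {j} a off = ¬-not λ uncut → not-¬
      (trans (uncut⇒monochromatic (c i) uncut j j₀)
             (trans (uncut⇒monochromatic (λ i′ → c i′ j₀) col₀ i i₀) a)) off

    offColour-cutCol : ∀ {a i j} → c i₀ j₀ ≡ a → c i j ≡ not a → cutCol j ≡ true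
    offColour-cutCol {i = i} {j} a off = ¬-not λ uncut → not-¬
      (trans (uncut⇒monochromatic (λ i′ → c i′ j) uncut i i₀)
             (trans (uncut⇒monochromatic (c i₀) row₀ j j₀) a)) off

    minority≤cutRows*cutCols : numTrue c ⊓ numFalse c ≤ count cutRow * count cutCol
    minority≤cutRows*cutCols with c i₀ j₀ in a
    ... | true  = ≤-trans (m⊓n≤n _ _) (countIn-⊆-rectangle
      (λ _ _ h → offColour-cutRow a (not-injective {y = false} h))
      (λ _ _ h → offColour-cutCol a (not-injective {y = false} h)) (allFin ℓ) (allFin ℓ))
    ... | false = ≤-trans (m⊓n≤m _ _) (countIn-⊆-rectangle
      (λ _ _ h → offColour-cutRow a h) (λ _ _ h → offColour-cutCol a h) (allFin ℓ) (allFin ℓ))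

  cutRows≤cutEdges : count cutRow ≤ cutEdges c
  cutRows≤cutEdges = m≤m+n _ _

  cutCols≤cutEdges : count cutCol ≤ cutEdges c
  cutCols≤cutEdges = m≤n+m _ _

  minority≤cutEdges² : numTrue c ⊓ numFalse c ≤ cutEdges c * cutEdges c
  minority≤cutEdges² with any? (λ i → cutRow i ≟ false) | any? (λ j → cutCol j ≟ false)
  ... | yes (_ , row₀) | yes (_ , col₀) =
    ≤-trans (minority≤cutRows*cutCols row₀ col₀) (*-mono-≤ cutRows≤cutEdges cutCols≤cutEdges)
  ... | no noUncutRow | _ = ≤-trans (m⊓n≤m _ _) (≤-trans
    (numTrue≤square (¬∃false⇒∀true noUncutRow)) (*-mono-≤ cutRows≤cutEdges cutRows≤cutEdges))
  ... | _ | no noUncutCol = ≤-trans (m⊓n≤m _ _) (≤-trans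
    (numTrue≤square (¬∃false⇒∀true noUncutCol)) (*-mono-≤ cutCols≤cutEdges cutCols≤cutEdges))

lemmaC3 : (ℓ : ℕ) → 1 ≤ ℓ → (c : Coloring ℓ) → (t₀ : ℕ) →
          t₀ ≤ numTrue c ⊓ numFalse c →
          t₀ ≤ cutEdges c * cutEdges c
lemmaC3 ℓ _ c t₀ t₀≤minority = ≤-trans t₀≤minority (minority≤cutEdges² c)
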